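{- Let $L$ be a bounded meet-semilattice, $\Sigma$ a set, $\mu:L\to{\cal P}(\Sigma)$ a weak Cartan map, and $\bar L_\mu={\cal C}_\mu(L)=\{\bigcap_{a\in A}\mu(a)\mid A\subseteq L\}$ ordered by inclusion, into which $L$ is embedded via $\mu$. Let $A\subseteq L$ be such that $\bigvee_L A$ exists. Then: (i) $\mu(\bigvee_L A)=\bigvee_{\bar L_\mu}\mu[A]$; (ii) if $\bigvee_L A$ is disjunctive, i.e. $\mu(\bigvee_L A)=\bigcup_{a\in A}\mu(a)$, then it is distributive in $L$, i.e. for every $b\in L$ the join $\bigvee_L\{b\wedge a\mid a\in A\}$ exists and equals $b\wedge\bigvee_L A$; (iii) if $\bigvee_L A$ is disjunctive then $\bigvee_{\bar L_\mu}\mu[A]$ is disjunctive, i.e. equals $\bigcup_{a\in A}\mu(a)$; (iv) if $\bigvee_L A$ is disjunctive then $\bigvee_{\bar L_\mu}\mu[A]$ is distributive in $\bar L_\mu$, i.e. $X\cap\bigvee_{\bar L_\mu}\mu[A]=\bigvee_{\bar L_\mu}\{X\cap\mu(a)\mid a\in A\}$ for all $X\in\bar L_\mu$.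
   Context: A weak Cartan map is an injective map $\mu:L\to{\cal P}(\Sigma)$ from a bounded meet-semilattice $L$ to the powerset of a set $\Sigma$ preserving finite meets ($\mu(a\wedge b)=\mu(a)\cap\mu(b)$) and the top ($\mu(1)=\Sigma$), with $\mu(0)=\emptyset$. $\bar L_\mu$ is a complete lattice whose infima are intersections; $\mu[A]=\{\mu(a)\mid a\in A\}$. -}

module Defs where

open import Level using (Level; _⊔_; suc)
open import Data.Product using (Σ; Σ-syntax; ∃; ∃-syntax; _×_; _,_)
open import Relation.Unary using (Pred; _⊆_; _≐_; _∩_; ∅; U; _∈_)
open import Relation.Binary.Lattice.Bundles using (BoundedMeetSemilattice)
open import Relation.Binary.Definitions using (Minimum)

record BoundedMSL (c ℓ₁ ℓ₂ : Level) : Set (suc (c ⊔ ℓ₁ ⊔ ℓ₂)) where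
  field
    bmsl    : BoundedMeetSemilattice c ℓ₁ ℓ₂
  open BoundedMeetSemilattice bmsl public
  field
    ⊥       : Carrier
    minimum : Minimum _≤_ ⊥

module _ {c ℓ₁ ℓ₂ : Level} (L : BoundedMSL c ℓ₁ ℓ₂) where
  open BoundedMSL L

  IsJoin : {p : Level} → Pred Carrier p → Carrier → Set (c ⊔ p ⊔ ℓ₂)
  IsJoin A j = (∀ a → a ∈ A → a ≤ j)
             × (∀ u → (∀ a → a ∈ A → a ≤ u) → j ≤ u)

  meetWith : Carrier → Pred Carrier c → Pred Carrier (c ⊔ ℓ₁)
  meetWith b A x = ∃[ a ] (a ∈ A × x ≈ (b ∧ a))

  module _ {Σ₀ : Set c} where

    record IsWeakCartan (μ : Carrier → Pred Σ₀ c) : Set (c ⊔ ℓ₁) where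
      field
        wellDefined : ∀ {a b} → a ≈ b → μ a ≐ μ b
        injective   : ∀ {a b} → μ a ≐ μ b → a ≈ b
        pres-∧      : ∀ a b → μ (a ∧ b) ≐ (μ a ∩ μ b)
        pres-⊤      : μ ⊤ ≐ U
        pres-⊥      : μ ⊥ ≐ ∅

    module _ (μ : Carrier → Pred Σ₀ c) where

      ⋂μ : Pred Carrier c → Pred Σ₀ c
      ⋂μ A σ = ∀ a → a ∈ A → σ ∈ μ a

      ⋃μ : Pred Carrier c → Pred Σ₀ c
      ⋃μ A σ = ∃[ a ] (a ∈ A × σ ∈ μ a)

      InLbar : Pred Σ₀ c → Set (suc c)
      InLbar X = ∃[ A ] (X ≐ ⋂μ A)

      image : Pred Carrier c → Pred (Pred Σ₀ c) c
      image A X = ∃[ a ] (a ∈ A × X ≐ μ a)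

      meetImage : Pred Σ₀ c → Pred Carrier c → Pred (Pred Σ₀ c) c
      meetImage X A Z = ∃[ a ] (a ∈ A × Z ≐ (X ∩ μ a))

      IsJoinLbar : Pred (Pred Σ₀ c) c → Pred Σ₀ c → Set (suc c)
      IsJoinLbar 𝒳 Y = InLbar Y
                     × (∀ X → X ∈ 𝒳 → X ⊆ Y)
                     × (∀ Z → InLbar Z → (∀ X → X ∈ 𝒳 → X ⊆ Z) → Y ⊆ Z)

-- A weak Cartan map is an order embedding of L into the closure system L̄_μ, and
-- every element of L̄_μ is an intersection of principal sets μ(b); hence an upper
-- bound of μ[A] in L̄_μ comes from upper bounds b of A in L, all of which lie above
-- ⋁ A.  This gives (i).  When μ(⋁ A) is the union of the μ(a), every point of
-- μ(b ∧ ⋁ A) lies in some μ(b ∧ a), which yields (ii); and since L̄_μ is closed under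
-- intersections, the same pointwise argument gives (iii) and (iv).
module Submission where

open import Defs
open import Level using (Level)
open import Data.Product using (_×_; _,_; proj₁; proj₂)
open import Data.Sum using (_⊎_; inj₁; inj₂)
open import Relation.Unary using (Pred; _≐_; _∩_; _⊆_; _∈_)
open import Relation.Unary.Properties using (≐-refl)
open import Relation.Binary.PropositionalEquality using (_≡_) renaming (refl to ≡-refl)

module WeakCartan {c ℓ₁ ℓ₂ : Level} (L : BoundedMSL c ℓ₁ ℓ₂) {Σ₀ : Set c}
    (μ : BoundedMSL.Carrier L → Pred Σ₀ c) (wc : IsWeakCartan L μ) where
  open BoundedMSL L
  open IsWeakCartan wc

  μ-mono : ∀ {x y} → x ≤ y → μ x ⊆ μ y
  μ-mono {x} {y} x≤y p = proj₂ (proj₁ (pres-∧ x y) (proj₁ (wellDefined x≈x∧y) p))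
    where
    x≈x∧y : x ≈ x ∧ y
    x≈x∧y = antisym (∧-greatest refl x≤y) (x∧y≤x x y)

  μ-reflects-≤ : ∀ {x y} → μ x ⊆ μ y → x ≤ y
  μ-reflects-≤ {x} {y} μx⊆μy = trans (reflexive (Eq.sym x∧y≈x)) (x∧y≤y x y)
    where
    x∧y≈x : x ∧ y ≈ x
    x∧y≈x = injective ( (λ p → proj₁ (proj₁ (pres-∧ x y) p))
                      , (λ p → proj₂ (pres-∧ x y) (p , μx⊆μy p)))

  μ-inLbar : ∀ a → InLbar L μ (μ a)
  μ-inLbar a = (_≡ a) , (λ { p _ ≡-refl → p }) , (λ q → q a ≡-refl)

  ∩-inLbar : ∀ {X Y} → InLbar L μ X → InLbar L μ Y → InLbar L μ (X ∩ Y)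
  ∩-inLbar (B , X≐) (C , Y≐) =
      (λ x → B x ⊎ C x)
    , (λ (px , py) → λ { a (inj₁ a∈B) → proj₁ X≐ px a a∈B
                       ; a (inj₂ a∈C) → proj₁ Y≐ py a a∈C })
    , (λ q → proj₂ X≐ (λ a a∈B → q a (inj₁ a∈B)) , proj₂ Y≐ (λ a a∈C → q a (inj₂ a∈C)))

  image-∋ : ∀ {A a} → a ∈ A → μ a ∈ image L μ A
  image-∋ {a = a} a∈A = a , a∈A , ≐-refl

  meetImage-∋ : ∀ {X A a} → a ∈ A → (X ∩ μ a) ∈ meetImage L μ X A
  meetImage-∋ {a = a} a∈A = a , a∈A , ≐-refl

  IsJoinLbar-unique : ∀ {𝒳 Y Y′} → IsJoinLbar L μ 𝒳 Y → IsJoinLbar L μ 𝒳 Y′ → Y ≐ Y′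
  IsJoinLbar-unique (i , u , l) (i′ , u′ , l′) = l _ i′ u′ , l′ _ i u

  μ-preserves-join : ∀ {A j} → IsJoin L A j → IsJoinLbar L μ (image L μ A) (μ j)
  μ-preserves-join {A} {j} (j-upper , j-least) = μ-inLbar j , upper , least
    where
    upper : ∀ X → X ∈ image L μ A → X ⊆ μ j
    upper X (a , a∈A , X≐μa) p = μ-mono (j-upper a a∈A) (proj₁ X≐μa p)

    least : ∀ Z → InLbar L μ Z → (∀ X → X ∈ image L μ A → X ⊆ Z) → μ j ⊆ Z
    least Z (B , Z≐⋂B) Z-upper p = proj₂ Z≐⋂B (λ b b∈B → μ-mono (j≤b b b∈B) p)
      where
      j≤b : ∀ b → b ∈ B → j ≤ b
      j≤b b b∈B = j-least b (λ a a∈A →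
        μ-reflects-≤ (λ q → proj₁ Z≐⋂B (Z-upper (μ a) (image-∋ a∈A) q) b b∈B))

  disjunctive-join-distrib : ∀ {A j} → IsJoin L A j → μ j ⊆ ⋃μ L μ A →
                             ∀ b → IsJoin L (meetWith L b A) (b ∧ j)
  disjunctive-join-distrib {A} {j} (j-upper , _) μj⊆⋃ b = upper , least
    where
    upper : ∀ x → x ∈ meetWith L b A → x ≤ b ∧ j
    upper x (a , a∈A , x≈b∧a) = trans (reflexive x≈b∧a)
      (∧-greatest (x∧y≤x b a) (trans (x∧y≤y b a) (j-upper a a∈A)))

    least : ∀ u → (∀ x → x ∈ meetWith L b A → x ≤ u) → b ∧ j ≤ u
    least u u-upper = μ-reflects-≤ λ p →
      let (pb , pj) = proj₁ (pres-∧ b j) p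
          (a , a∈A , pa) = μj⊆⋃ pj
      in μ-mono (u-upper (b ∧ a) (a , a∈A , Eq.refl)) (proj₂ (pres-∧ b a) (pb , pa))

  disjunctive-joinLbar : ∀ {A j Y} → IsJoin L A j → μ j ≐ ⋃μ L μ A →
                         IsJoinLbar L μ (image L μ A) Y → Y ≐ ⋃μ L μ A
  disjunctive-joinLbar J (μj⊆⋃ , ⋃⊆μj) JY =
    let (Y⊆μj , μj⊆Y) = IsJoinLbar-unique JY (μ-preserves-join J)
    in (λ p → μj⊆⋃ (Y⊆μj p)) , (λ p → μj⊆Y (⋃⊆μj p))

  ∩-distrib-disjunctive-joinLbar : ∀ {A X Y} → InLbar L μ X →
    IsJoinLbar L μ (image L μ A) Y → Y ⊆ ⋃μ L μ A →
    IsJoinLbar L μ (meetImage L μ X A) (X ∩ Y)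
  ∩-distrib-disjunctive-joinLbar {A} {X} {Y} X∈L̄ (Y∈L̄ , Y-upper , _) Y⊆⋃ =
    ∩-inLbar X∈L̄ Y∈L̄ , upper , least
    where
    upper : ∀ Z → Z ∈ meetImage L μ X A → Z ⊆ X ∩ Y
    upper Z (a , a∈A , Z≐X∩μa) p =
      let (px , pa) = proj₁ Z≐X∩μa p
      in px , Y-upper (μ a) (image-∋ a∈A) pa

    least : ∀ W → InLbar L μ W → (∀ Z → Z ∈ meetImage L μ X A → Z ⊆ W) → X ∩ Y ⊆ W
    least W _ W-upper (px , py) =
      let (a , a∈A , pa) = Y⊆⋃ py
      in W-upper (X ∩ μ a) (meetImage-∋ a∈A) (px , pa)

proposition16 : {c ℓ₁ ℓ₂ : Level} (L : BoundedMSL c ℓ₁ ℓ₂) {Σ₀ : Set c}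
    (μ : BoundedMSL.Carrier L → Pred Σ₀ c) → IsWeakCartan L μ →
    (A : Pred (BoundedMSL.Carrier L) c) (j : BoundedMSL.Carrier L) → IsJoin L A j →
    IsJoinLbar L μ (image L μ A) (μ j)
    × (μ j ≐ ⋃μ L μ A →
        (∀ b → IsJoin L (meetWith L b A) (BoundedMSL._∧_ L b j))
        × (∀ Y → IsJoinLbar L μ (image L μ A) Y → Y ≐ ⋃μ L μ A)
        × (∀ X → InLbar L μ X → ∀ Y → IsJoinLbar L μ (image L μ A) Y →
             IsJoinLbar L μ (meetImage L μ X A) (X ∩ Y)))
proposition16 L μ wc A j J =
    μ-preserves-join J
  , λ disj →
      disjunctive-join-distrib J (proj₁ disj)
    , (λ Y JY → disjunctive-joinLbar J disj JY)
    , (λ X X∈L̄ Y JY → ∩-distrib-disjunctive-joinLbar X∈L̄ JY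
                         (proj₁ (disjunctive-joinLbar J disj JY)))
  where open WeakCartan L μ wc
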